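{- Let $g\colon\mathbb{N}\to\mathbb{N}$ be any non-decreasing unbounded function. For all non-negative integers $x,y,k$, $(x,y)\in A_k$ if and only if $\phi_g(x,y)\in B_k$.
   Context: $\mathbb{N}$ denotes the non-negative integers. $g$ is non-decreasing if $x\le y$ implies $g(x)\le g(y)$, and unbounded if for every $y$ there is $x$ with $g(x)\ge y$. Define $g^+(y)$ to be the smallest $x\in\mathbb{N}$ with $g(x)\ge y$. The step points of $g$ are the elements of the range of $g^+$, listed increasingly as $s_0<s_1<s_2<\cdots$. For $k\in\mathbb{N}$ let $A_k=\{(x,y)\in\mathbb{N}^2 : x<s_{k+1}\text{ and } y\le g(s_k)\}$ and $B_k=\{0,1,\ldots,s_{k+1}(g(s_k)+1)-1\}$. Define $\phi_g(x,y)=y\cdot g^+(y)+x$ if $y>g(x)$, and $\phi_g(x,y)=x(g(x)+1)+y$ otherwise. -}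

module Defs where

open import Data.Nat using (ℕ; zero; suc; _+_; _*_; _≤_; _<_; _≤?_; _<?_)
open import Data.Product using (Σ; ∃; _×_; _,_; proj₁)
open import Relation.Nullary using (yes; no)
open import Relation.Binary.PropositionalEquality using (_≡_)
open import Function.Bundles using (_⇔_)

NonDecreasing : (ℕ → ℕ) → Set
NonDecreasing g = ∀ {x y} → x ≤ y → g x ≤ g y

Unbounded : (ℕ → ℕ) → Set
Unbounded g = ∀ y → ∃ λ x → y ≤ g x

findFrom : (ℕ → ℕ) → ℕ → ℕ → ℕ → ℕ
findFrom g y i zero = i
findFrom g y i (suc fuel) with y ≤? g i
... | yes _ = i
... | no  _ = findFrom g y (suc i) fuel

-- g⁺ y = the smallest x ∈ ℕ with g x ≥ y  (search over 0..w, where w is the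
-- witness supplied by unboundedness, which satisfies y ≤ g w)
g⁺ : (g : ℕ → ℕ) → Unbounded g → ℕ → ℕ
g⁺ g unb y = findFrom g y 0 (proj₁ (unb y))

InRange : (ℕ → ℕ) → ℕ → Set
InRange f x = ∃ λ y → f y ≡ x

-- s lists the range of f increasingly: s is strictly increasing and its
-- image is exactly the range of f  (this determines s uniquely)
ListsRangeIncreasingly : (ℕ → ℕ) → (ℕ → ℕ) → Set
ListsRangeIncreasingly f s =
  (∀ k → s k < s (suc k)) × (∀ x → InRange f x ⇔ (∃ λ k → s k ≡ x))

InA : (g s : ℕ → ℕ) → ℕ → ℕ → ℕ → Set
InA g s k x y = (x < s (suc k)) × (y ≤ g (s k))

InB : (g s : ℕ → ℕ) → ℕ → ℕ → Set
InB g s k n = n < s (suc k) * (g (s k) + 1)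

φ : (g : ℕ → ℕ) → Unbounded g → ℕ → ℕ → ℕ
φ g unb x y with g x <? y
... | yes _ = y * g⁺ g unb y + x
... | no  _ = x * (g x + 1) + y

module Submission where

-- Write S = s (k+1) and G = g (s k).  Everything rests on two
-- facts about the "block" [s k, S) of consecutive step points:
--   (1) for y > G the least point reaching y lies beyond the block,
--       i.e.  G < y → S ≤ g⁺ y ;
--   (2) g stays at most G inside [0, S) and exceeds G from S on,
--       i.e.  x < S → g x ≤ G  and  S ≤ x → G < g x .
-- (1) holds because g⁺ y is a step point s j with g (s k) < g (s j), hence
-- k < j; (2) follows from (1) and from the fact that S, being g⁺ z for some z,
-- cannot have z ≤ G (else g⁺ z ≤ s k < S).
-- With these, each branch of φ is handled by elementary bounds: a "digit"
-- estimate  q < Q → r < R → q·R + r < Q·R  shows that points of A_k land in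
-- B_k, and the estimate  Q·R ≤ q·r + e  (for Q ≤ q, R ≤ r) shows that points
-- outside A_k land outside B_k.  The file first establishes the specification
-- of the search defining g⁺, then monotonicity facts, then the two arithmetic
-- estimates, then the block facts, and finally the theorem branch by branch.

open import Defs
open import Data.Nat using (ℕ; zero; suc; _+_; _*_; _≤_; _<_; _≤?_; _<?_; z≤n; s≤s)
open import Data.Nat.Properties
open import Data.Product using (_,_; proj₁; proj₂)
open import Data.Sum using (inj₁; inj₂)
open import Relation.Nullary using (yes; no; contradiction)
open import Relation.Binary.PropositionalEquality using (refl; sym; subst)
open import Function.Bundles using (_⇔_; mk⇔; Equivalence)

findFrom-reaches : (g : ℕ → ℕ) (y i fuel : ℕ)
  → y ≤ g (i + fuel) → y ≤ g (findFrom g y i fuel)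
findFrom-reaches g y i zero h = subst (λ t → y ≤ g t) (+-identityʳ i) h
findFrom-reaches g y i (suc fuel) h with y ≤? g i
... | yes y≤gi = y≤gi
... | no  _    = findFrom-reaches g y (suc i) fuel (subst (λ t → y ≤ g t) (+-suc i fuel) h)

findFrom-least : (g : ℕ → ℕ) (y i fuel x : ℕ)
  → i ≤ x → y ≤ g x → findFrom g y i fuel ≤ x
findFrom-least g y i zero x i≤x h = i≤x
findFrom-least g y i (suc fuel) x i≤x h with y ≤? g i
... | yes _   = i≤x
... | no  y≰gi with m≤n⇒m<n∨m≡n i≤x
...   | inj₁ i<x  = findFrom-least g y (suc i) fuel x i<x h
...   | inj₂ refl = contradiction h y≰gi

g⁺-reaches : (g : ℕ → ℕ) (unb : Unbounded g) (y : ℕ) → y ≤ g (g⁺ g unb y)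
g⁺-reaches g unb y = findFrom-reaches g y 0 (proj₁ (unb y)) (proj₂ (unb y))

g⁺-least : (g : ℕ → ℕ) (unb : Unbounded g) {y x : ℕ} → y ≤ g x → g⁺ g unb y ≤ x
g⁺-least g unb {y} {x} = findFrom-least g y 0 (proj₁ (unb y)) x z≤n

nonDecreasing-reflects-< : (f : ℕ → ℕ) → NonDecreasing f → ∀ {a b} → f a < f b → a < b
nonDecreasing-reflects-< f mono {a} {b} fa<fb =
  ≰⇒> (λ b≤a → <⇒≱ fa<fb (mono b≤a))

stepwise-increasing-nonDecreasing : (s : ℕ → ℕ) → (∀ k → s k < s (suc k)) → NonDecreasing s
stepwise-increasing-nonDecreasing s inc {j} {zero} z≤n = ≤-refl
stepwise-increasing-nonDecreasing s inc {j} {suc k} j≤1+k with m≤n⇒m<n∨m≡n j≤1+k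
... | inj₂ refl      = ≤-refl
... | inj₁ (s≤s j≤k) = ≤-trans (stepwise-increasing-nonDecreasing s inc j≤k) (<⇒≤ (inc k))

digit-bound : ∀ {q Q r R} → q < Q → r < R → q * R + r < Q * R
digit-bound {q} {Q} {r} {R} q<Q r<R = begin-strict
  q * R + r  <⟨ +-monoʳ-< (q * R) r<R ⟩
  q * R + R  ≡⟨ +-comm (q * R) R ⟩
  suc q * R  ≤⟨ *-monoˡ-≤ R q<Q ⟩
  Q * R      ∎
  where open ≤-Reasoning

product-bound : ∀ {a b c d} e → a ≤ c → b ≤ d → a * b ≤ c * d + e
product-bound {c = c} {d} e a≤c b≤d = ≤-trans (*-mono-≤ a≤c b≤d) (m≤m+n (c * d) e)

≤⇒<+1 : ∀ {m n} → m ≤ n → m < n + 1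
≤⇒<+1 {m} {n} m≤n = subst (m <_) (+-comm 1 n) (s≤s m≤n)

<⇒+1≤ : ∀ {m n} → m < n → m + 1 ≤ n
<⇒+1≤ {m} {n} m<n = subst (_≤ n) (+-comm 1 m) m<n

module Block (g : ℕ → ℕ) (mono : NonDecreasing g) (unb : Unbounded g)
             (s : ℕ → ℕ) (lists : ListsRangeIncreasingly (g⁺ g unb) s) (k : ℕ) where

  S G : ℕ
  S = s (suc k)
  G = g (s k)

  s-inc : ∀ j → s j < s (suc j)
  s-inc = proj₁ lists

  s-mono : NonDecreasing s
  s-mono = stepwise-increasing-nonDecreasing s s-inc

  late-reach : ∀ {y} → G < y → S ≤ g⁺ g unb y
  late-reach {y} G<y with Equivalence.to (proj₂ lists (g⁺ g unb y)) (y , refl)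
  ... | j , sj≡g⁺y = subst (S ≤_) sj≡g⁺y (s-mono k<j)
    where
    G<g[sj] : G < g (s j)
    G<g[sj] = <-≤-trans G<y (subst (λ t → y ≤ g t) (sym sj≡g⁺y) (g⁺-reaches g unb y))

    k<j : k < j
    k<j = nonDecreasing-reflects-< s s-mono (nonDecreasing-reflects-< g mono G<g[sj])

  jump-at-end : G < g S
  jump-at-end with Equivalence.from (proj₂ lists S) (suc k , refl)
  ... | z , g⁺z≡S with G <? z
  ...   | yes G<z = <-≤-trans G<z (subst (λ t → z ≤ g t) g⁺z≡S (g⁺-reaches g unb z))
  ...   | no  G≮z =
    contradiction (subst (_≤ s k) g⁺z≡S (g⁺-least g unb (≮⇒≥ G≮z))) (<⇒≱ (s-inc k))

  small-below-end : ∀ {x} → x < S → g x ≤ G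
  small-below-end {x} x<S =
    ≮⇒≥ (λ G<gx → <⇒≱ x<S (≤-trans (late-reach G<gx) (g⁺-least g unb ≤-refl)))

  large-from-end : ∀ {x} → S ≤ x → G < g x
  large-from-end S≤x = <-≤-trans jump-at-end (mono S≤x)

  upper-branch : ∀ {x y} → g x < y
    → InA g s k x y ⇔ (y * g⁺ g unb y + x < S * (G + 1))
  upper-branch {x} {y} gx<y = mk⇔ into back
    where
    into : InA g s k x y → y * g⁺ g unb y + x < S * (G + 1)
    into (x<S , y≤G) = begin-strict
      y * g⁺ g unb y + x  ≤⟨ +-monoˡ-≤ x (*-monoʳ-≤ y g⁺y≤S) ⟩
      y * S + x           <⟨ digit-bound (≤⇒<+1 y≤G) x<S ⟩
      (G + 1) * S         ≡⟨ *-comm (G + 1) S ⟩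
      S * (G + 1)         ∎
      where
      open ≤-Reasoning
      g⁺y≤S : g⁺ g unb y ≤ S
      g⁺y≤S = ≤-trans (g⁺-least g unb y≤G) (<⇒≤ (s-inc k))

    back : y * g⁺ g unb y + x < S * (G + 1) → InA g s k x y
    back bound = x<S , y≤G
      where
      y≤G : y ≤ G
      y≤G = ≮⇒≥ λ G<y → <⇒≱ bound
        (subst (_≤ y * g⁺ g unb y + x) (*-comm (G + 1) S)
               (product-bound x (<⇒+1≤ G<y) (late-reach G<y)))

      x<S : x < S
      x<S = ≰⇒> λ S≤x → <⇒≱ (<-≤-trans (large-from-end S≤x) (<⇒≤ gx<y)) y≤G

  lower-branch : ∀ {x y} → y ≤ g x
    → InA g s k x y ⇔ (x * (g x + 1) + y < S * (G + 1))
  lower-branch {x} {y} y≤gx = mk⇔ into back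
    where
    into : InA g s k x y → x * (g x + 1) + y < S * (G + 1)
    into (x<S , _) = begin-strict
      x * (g x + 1) + y  ≤⟨ +-monoˡ-≤ y (*-monoʳ-≤ x (+-monoˡ-≤ 1 gx≤G)) ⟩
      x * (G + 1) + y    <⟨ digit-bound x<S (≤⇒<+1 (≤-trans y≤gx gx≤G)) ⟩
      S * (G + 1)        ∎
      where
      open ≤-Reasoning
      gx≤G : g x ≤ G
      gx≤G = small-below-end x<S

    back : x * (g x + 1) + y < S * (G + 1) → InA g s k x y
    back bound = x<S , ≤-trans y≤gx (small-below-end x<S)
      where
      x<S : x < S
      x<S = ≰⇒> λ S≤x → <⇒≱ bound
        (product-bound y S≤x (+-monoˡ-≤ 1 (<⇒≤ (large-from-end S≤x))))

corollary4p8 : (g : ℕ → ℕ) → NonDecreasing g → (unb : Unbounded g)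
    → (s : ℕ → ℕ) → ListsRangeIncreasingly (g⁺ g unb) s
    → (x y k : ℕ) → InA g s k x y ⇔ InB g s k (φ g unb x y)
corollary4p8 g mono unb s lists x y k with g x <? y
... | yes gx<y = upper-branch gx<y
  where open Block g mono unb s lists k
... | no  gx≮y = lower-branch (≮⇒≥ gx≮y)
  where open Block g mono unb s lists k
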